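{- Let $q>2$ be an odd integer. Suppose $n=qm+r$ with integers $0\le r<q$ and $m\ge1$. Then $$f_{2,q}(n)=1+f_{2,q}(1)+f_{2,q}(2)+\cdots+f_{2,q}(m).$$
   Context: $\mathbb{N}$ denotes the set of nonnegative integers. For an odd integer $q>2$, $f_{2,q}(n)$ denotes the number of different expressions of the positive integer $n$ as a sum of distinct terms taken from $\{2^{\alpha}q^{\beta}:\alpha,\beta\in\mathbb{N}\}$ (i.e. the number of finite subsets of this set whose elements sum to $n$). -}

module Defs where

open import Data.Nat using (ℕ; _^_; _*_; _≤?_; _≟_)
open import Data.List using (List; []; _∷_; _++_; map; length; filter; upTo; concatMap)
open import Data.List.Membership.DecPropositional _≟_ using (_∈?_)
open import Relation.Nullary using (yes; no)
open import Data.Nat.ListAction using (sum)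

dedup : List ℕ → List ℕ
dedup [] = []
dedup (x ∷ xs) with x ∈? dedup xs
... | yes _ = dedup xs
... | no  _ = x ∷ dedup xs

-- All elements 2^α q^β (α, β ∈ ℕ) that are ≤ n, without repetition.
-- (If 2^α q^β ≤ n with n ≥ 1 then α, β ≤ n, so the ranges below suffice.)
terms : ℕ → ℕ → List ℕ
terms q n =
  dedup (filter (_≤? n)
    (concatMap (λ a → map (λ b → 2 ^ a * q ^ b) (upTo (n Data.Nat.+ 1))) (upTo (n Data.Nat.+ 1))))

-- All sublists (= subsets, for a list without repetition).
sublists : List ℕ → List (List ℕ)
sublists [] = [] ∷ []
sublists (x ∷ xs) = sublists xs ++ map (x ∷_) (sublists xs)

-- f_{2,q}(n): number of finite subsets of {2^α q^β} whose elements sum to n.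
-- Every such subset consists of elements ≤ n, hence is a subset of terms q n.
f : ℕ → ℕ → ℕ
f q n = length (filter (λ s → sum s ≟ n) (sublists (terms q n)))

{-# OPTIONS --safe #-}
-- Write Σsublists w L for the sum of w (sum s) over all sublists s of L; then f q n is Σsublists of the
-- indicator of n over the elements of S = {2^a q^b} up to n. For n = q m + r with r < q, such an element
-- is either a power of 2 or q z with z ∈ S, z ≤ m, and no element is both since q is odd. As every number
-- below 2^n has exactly one binary expansion, a representation of n is determined by its multiples of q,
-- q z₁ + … + q zₖ, subject only to q (z₁ + … + zₖ) ≤ n, i.e. z₁ + … + zₖ ≤ m. Grouping the sets {z₁, …, zₖ}
-- by their sum j ≤ m gives f q 0 + f q 1 + … + f q m, and f q 0 = 1.
module Submission where

open import Defs
import Algebra.Properties.CommutativeSemigroup as CommutativeSemigroupProperties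
open import Data.Bool using (Bool; true; false)
open import Data.Bool.Properties using (T-≡)
open import Data.Empty using (⊥-elim)
open import Data.List using (List; []; _∷_; _++_; map; length; filter; upTo; concatMap; applyUpTo)
open import Data.List.Properties using (map-++; map-∘; map-applyUpTo; applyUpTo-∷ʳ; filter-accept; filter-reject)
open import Data.List.Membership.Propositional using (_∈_; lose)
open import Data.List.Membership.Propositional.Properties
  using (∈-filter⁺; ∈-filter⁻; ∈-concatMap⁺; ∈-concatMap⁻; ∈-map⁺; ∈-map⁻; ∈-++⁺ˡ; ∈-++⁺ʳ; ∈-++⁻; ∈-upTo⁺; ∈-applyUpTo⁺; ∈-applyUpTo⁻)
open import Data.List.Membership.Propositional.Properties.WithK using (unique∧set⇒bag)
open import Data.List.Relation.Binary.BagAndSetEquality using (∼bag⇒↭)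
open import Data.List.Relation.Binary.Disjoint.Propositional using (Disjoint)
open import Data.List.Relation.Binary.Permutation.Propositional using (_↭_; refl; prep; swap; trans; ↭-sym; ↭-trans; ↭-reflexive)
open import Data.List.Relation.Binary.Permutation.Propositional.Properties using (∷↭∷ʳ)
open import Data.List.Relation.Unary.All.Properties using (¬Any⇒All¬)
open import Data.List.Relation.Unary.Any using (here; there; satisfied)
open import Data.List.Relation.Unary.Unique.Propositional using (Unique; []; _∷_)
import Data.List.Relation.Unary.Unique.Propositional.Properties as Unique
open import Data.Nat using (ℕ; zero; suc; _+_; _*_; _^_; _<_; _≤_; _≤?_; _≟_; _≡ᵇ_; _≤ᵇ_; _<ᵇ_; s≤s; z<s; s<s; NonZero; >-nonZero)
open import Data.Nat.Properties
open import Data.List.Membership.DecPropositional _≟_ using (_∈?_)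
open import Data.Nat.Coprimality using (Coprime; coprime-divisor)
open import Data.Nat.Divisibility using (_∣_; divides; ∣1⇒≡1; 0∣⇒≡0; ∣⇒≤)
open import Data.Nat.ListAction using (sum)
open import Data.Nat.ListAction.Properties using (sum-++)
open import Data.Product using (∃; ∃₂; _×_; _,_; proj₁)
open import Data.Sum using (_⊎_; inj₁; inj₂)
open import Function using (_∘_; const; Equivalence; mk⇔)
open import Level using (Level)
open import Relation.Nullary using (¬_; yes; no; does)
open import Relation.Nullary.Decidable using (dec-false; does-⇔)
open import Relation.Unary using (Pred; Decidable)
open import Relation.Binary.PropositionalEquality using (_≡_; refl; sym; cong; cong₂; _≗_; module ≡-Reasoning)
import Relation.Binary.PropositionalEquality as ≡

private
  module +-CS = CommutativeSemigroupProperties +-commutativeSemigroup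
  module *-CS = CommutativeSemigroupProperties *-commutativeSemigroup

  variable
    ℓ ℓ′ : Level
    A : Set ℓ

𝟙 : Bool → ℕ
𝟙 true  = 1
𝟙 false = 0

length-filter≡sum : {P : Pred A ℓ′} (P? : Decidable P) (xs : List A) →
  length (filter P? xs) ≡ sum (map (𝟙 ∘ does ∘ P?) xs)
length-filter≡sum P? []       = refl
length-filter≡sum P? (x ∷ xs) with does (P? x)
... | true  = cong suc (length-filter≡sum P? xs)
... | false = length-filter≡sum P? xs

𝟙≡ᵇ-above : ∀ {n t} → n < t → 𝟙 (t ≡ᵇ n) ≡ 0
𝟙≡ᵇ-above {n} {t} n<t = cong 𝟙 (dec-false (t ≟ n) (>⇒≢ n<t))

≤ᵇ-suc : ∀ m n → (suc m ≤ᵇ suc n) ≡ (m ≤ᵇ n)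
≤ᵇ-suc zero    n = refl
≤ᵇ-suc (suc m) n = refl

sum-applyUpTo-0 : ∀ N → sum (applyUpTo (const 0) N) ≡ 0
sum-applyUpTo-0 zero    = refl
sum-applyUpTo-0 (suc N) = sum-applyUpTo-0 N

sum-applyUpTo-+ : ∀ (w : ℕ → ℕ) a b →
  sum (applyUpTo w (a + b)) ≡ sum (applyUpTo w a) + sum (applyUpTo (w ∘ (a +_)) b)
sum-applyUpTo-+ w zero    b = refl
sum-applyUpTo-+ w (suc a) b = ≡.trans (cong (w 0 +_) (sum-applyUpTo-+ (w ∘ suc) a b)) (sym (+-assoc (w 0) _ _))

sum-applyUpTo-cong : ∀ {u v : ℕ → ℕ} N → (∀ {j} → j < N → u j ≡ v j) →
  sum (applyUpTo u N) ≡ sum (applyUpTo v N)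
sum-applyUpTo-cong zero    u≡v = refl
sum-applyUpTo-cong (suc N) u≡v = cong₂ _+_ (u≡v z<s) (sum-applyUpTo-cong N (u≡v ∘ s<s))

Σ-indicator : ∀ n N → sum (applyUpTo (λ u → 𝟙 (u ≡ᵇ n)) N) ≡ 𝟙 (n <ᵇ N)
Σ-indicator n       zero    = refl
Σ-indicator zero    (suc N) = cong suc (sum-applyUpTo-0 N)
Σ-indicator (suc n) (suc N) = Σ-indicator n N

Σ-indicator-+ : ∀ t {n N} → n < N → sum (applyUpTo (λ u → 𝟙 (t + u ≡ᵇ n)) N) ≡ 𝟙 (t ≤ᵇ n)
Σ-indicator-+ zero    {n} {N} n<N = ≡.trans (Σ-indicator n N) (cong 𝟙 (Equivalence.to T-≡ (<⇒<ᵇ n<N)))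
Σ-indicator-+ (suc t) {zero}  {N} _   = sum-applyUpTo-0 N
Σ-indicator-+ (suc t) {suc n}     n<N = ≡.trans (Σ-indicator-+ t (<⇒≤ n<N)) (sym (cong 𝟙 (≤ᵇ-suc t n)))

𝟙≤ᵇ≡Σ : ∀ t m → 𝟙 (t ≤ᵇ m) ≡ sum (applyUpTo (λ j → 𝟙 (t ≡ᵇ j)) (suc m))
𝟙≤ᵇ≡Σ zero    m       = cong suc (sym (sum-applyUpTo-0 m))
𝟙≤ᵇ≡Σ (suc t) zero    = refl
𝟙≤ᵇ≡Σ (suc t) (suc m) = ≡.trans (cong 𝟙 (≤ᵇ-suc t m)) (𝟙≤ᵇ≡Σ t m)

Σsublists : (ℕ → ℕ) → List ℕ → ℕ
Σsublists w []       = w 0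
Σsublists w (x ∷ xs) = Σsublists w xs + Σsublists (w ∘ (x +_)) xs

sum-map-sublists : ∀ w xs → sum (map (w ∘ sum) (sublists xs)) ≡ Σsublists w xs
sum-map-sublists w []       = +-identityʳ (w 0)
sum-map-sublists w (x ∷ xs) = begin
  sum (map (w ∘ sum) (S ++ map (x ∷_) S))
    ≡⟨ cong sum (map-++ (w ∘ sum) S (map (x ∷_) S)) ⟩
  sum (map (w ∘ sum) S ++ map (w ∘ sum) (map (x ∷_) S))
    ≡⟨ sum-++ (map (w ∘ sum) S) _ ⟩
  sum (map (w ∘ sum) S) + sum (map (w ∘ sum) (map (x ∷_) S))
    ≡⟨ cong₂ _+_ (sum-map-sublists w xs) (cong sum (sym (map-∘ S))) ⟩
  Σsublists w xs + sum (map (w ∘ (x +_) ∘ sum) S)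
    ≡⟨ cong (Σsublists w xs +_) (sum-map-sublists (w ∘ (x +_)) xs) ⟩
  Σsublists w (x ∷ xs) ∎
  where
  open ≡-Reasoning
  S : List (List ℕ)
  S = sublists xs

Σsublists-cong : ∀ {u v} → u ≗ v → ∀ xs → Σsublists u xs ≡ Σsublists v xs
Σsublists-cong u≗v []       = u≗v 0
Σsublists-cong u≗v (x ∷ xs) = cong₂ _+_ (Σsublists-cong u≗v xs) (Σsublists-cong (u≗v ∘ (x +_)) xs)

Σsublists-0 : ∀ xs → Σsublists (const 0) xs ≡ 0
Σsublists-0 []       = refl
Σsublists-0 (x ∷ xs) = cong₂ _+_ (Σsublists-0 xs) (Σsublists-0 xs)

Σsublists-+ : ∀ u v xs → Σsublists (λ t → u t + v t) xs ≡ Σsublists u xs + Σsublists v xs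
Σsublists-+ u v []       = refl
Σsublists-+ u v (x ∷ xs) = ≡.trans
  (cong₂ _+_ (Σsublists-+ u v xs) (Σsublists-+ (u ∘ (x +_)) (v ∘ (x +_)) xs))
  (+-CS.interchange (Σsublists u xs) (Σsublists v xs) _ _)

Σsublists-sum : ∀ (v : ℕ → ℕ → ℕ) N xs →
  Σsublists (λ t → sum (applyUpTo (λ j → v j t) N)) xs ≡ sum (applyUpTo (λ j → Σsublists (v j) xs) N)
Σsublists-sum v zero    xs = Σsublists-0 xs
Σsublists-sum v (suc N) xs = ≡.trans (Σsublists-+ (v 0) _ xs)
  (cong (Σsublists (v 0) xs +_) (Σsublists-sum (v ∘ suc) N xs))

Σsublists-↭ : ∀ {xs ys} → xs ↭ ys → ∀ w → Σsublists w xs ≡ Σsublists w ys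
Σsublists-↭ refl                   w = refl
Σsublists-↭ (prep x p)             w = cong₂ _+_ (Σsublists-↭ p w) (Σsublists-↭ p (w ∘ (x +_)))
Σsublists-↭ (swap {xs} {ys} x y p) w = ≡.trans
  (+-CS.interchange (Σsublists w xs) (Σsublists (w ∘ (y +_)) xs) (Σsublists (w ∘ (x +_)) xs) _)
  (cong₂ _+_
    (cong₂ _+_ (Σsublists-↭ p w) (Σsublists-↭ p (w ∘ (x +_))))
    (cong₂ _+_ (Σsublists-↭ p (w ∘ (y +_)))
               (≡.trans (Σsublists-↭ p _) (Σsublists-cong (λ t → cong w (+-CS.x∙yz≈y∙xz x y t)) ys))))
Σsublists-↭ (trans p p′)           w = ≡.trans (Σsublists-↭ p w) (Σsublists-↭ p′ w)

Σsublists-++ : ∀ w xs ys → Σsublists w (xs ++ ys) ≡ Σsublists (λ t → Σsublists (w ∘ (t +_)) ys) xs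
Σsublists-++ w []       ys = refl
Σsublists-++ w (x ∷ xs) ys = cong₂ _+_ (Σsublists-++ w xs ys) (≡.trans (Σsublists-++ (w ∘ (x +_)) xs ys)
  (Σsublists-cong (λ t → Σsublists-cong (λ u → cong w (sym (+-assoc x t u))) ys) xs))

Σsublists-map-* : ∀ w c xs → Σsublists w (map (c *_) xs) ≡ Σsublists (w ∘ (c *_)) xs
Σsublists-map-* w c []       = cong w (sym (*-zeroʳ c))
Σsublists-map-* w c (x ∷ xs) = cong₂ _+_ (Σsublists-map-* w c xs) (≡.trans (Σsublists-map-* (w ∘ (c * x +_)) c xs)
  (Σsublists-cong (λ t → cong w (sym (*-distribˡ-+ c x t))) xs))

Σsublists-filter-≤ : ∀ {w} n → (∀ {t} → n < t → w t ≡ 0) →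
  ∀ xs → Σsublists w (filter (_≤? n) xs) ≡ Σsublists w xs
Σsublists-filter-≤ n w>n≡0 []       = refl
Σsublists-filter-≤ {w} n w>n≡0 (x ∷ xs) with x ≤? n
... | yes x≤n = ≡.trans (cong (Σsublists w) (filter-accept (_≤? n) x≤n)) (cong₂ _+_
  (Σsublists-filter-≤ n w>n≡0 xs)
  (Σsublists-filter-≤ n (λ {t} n<t → w>n≡0 (<-≤-trans n<t (m≤n+m t x))) xs))
... | no  x≰n = begin
  Σsublists w (filter (_≤? n) (x ∷ xs))        ≡⟨ cong (Σsublists w) (filter-reject (_≤? n) x≰n) ⟩
  Σsublists w (filter (_≤? n) xs)              ≡⟨ Σsublists-filter-≤ n w>n≡0 xs ⟩
  Σsublists w xs                               ≡⟨ +-identityʳ _ ⟨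
  Σsublists w xs + 0                           ≡⟨ cong (Σsublists w xs +_) (Σsublists-0 xs) ⟨
  Σsublists w xs + Σsublists (const 0) xs      ≡⟨ cong (Σsublists w xs +_) (Σsublists-cong x+t≡0 xs) ⟨
  Σsublists w xs + Σsublists (w ∘ (x +_)) xs   ∎
  where
  open ≡-Reasoning
  x+t≡0 : ∀ t → w (x + t) ≡ 0
  x+t≡0 t = w>n≡0 (<-≤-trans (≰⇒> x≰n) (m≤m+n x t))

-- Existence and uniqueness of binary expansions of the numbers below 2 ^ K.
Σsublists-powers : ∀ w K → Σsublists w (applyUpTo (2 ^_) K) ≡ sum (applyUpTo w (2 ^ K))
Σsublists-powers w zero    = sym (+-identityʳ (w 0))
Σsublists-powers w (suc K) = begin
  Σsublists w (applyUpTo (2 ^_) (suc K))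
    ≡⟨ Σsublists-↭ (↭-trans (↭-reflexive (sym (applyUpTo-∷ʳ (2 ^_) K))) (↭-sym (∷↭∷ʳ (2 ^ K) _))) w ⟩
  Σsublists w (2 ^ K ∷ applyUpTo (2 ^_) K)
    ≡⟨ cong₂ _+_ (Σsublists-powers w K) (Σsublists-powers (w ∘ (2 ^ K +_)) K) ⟩
  sum (applyUpTo w (2 ^ K)) + sum (applyUpTo (w ∘ (2 ^ K +_)) (2 ^ K))
    ≡⟨ sum-applyUpTo-+ w (2 ^ K) (2 ^ K) ⟨
  sum (applyUpTo w (2 ^ K + 2 ^ K))
    ≡⟨ cong (λ N → sum (applyUpTo w (2 ^ K + N))) (+-identityʳ (2 ^ K)) ⟨
  sum (applyUpTo w (2 ^ suc K)) ∎
  where open ≡-Reasoning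

Σsublists-++-powers : ∀ {n K} → n < 2 ^ K → ∀ xs →
  Σsublists (λ t → 𝟙 (t ≡ᵇ n)) (xs ++ applyUpTo (2 ^_) K) ≡ Σsublists (λ t → 𝟙 (t ≤ᵇ n)) xs
Σsublists-++-powers {n} {K} n<2^K xs = ≡.trans (Σsublists-++ _ xs (applyUpTo (2 ^_) K))
  (Σsublists-cong (λ t → ≡.trans (Σsublists-powers _ K) (Σ-indicator-+ t n<2^K)) xs)

Σsublists-≤ᵇ : ∀ m xs →
  Σsublists (λ t → 𝟙 (t ≤ᵇ m)) xs ≡ sum (applyUpTo (λ j → Σsublists (λ t → 𝟙 (t ≡ᵇ j)) xs) (suc m))
Σsublists-≤ᵇ m xs = ≡.trans (Σsublists-cong (λ t → 𝟙≤ᵇ≡Σ t m) xs) (Σsublists-sum (λ j t → 𝟙 (t ≡ᵇ j)) (suc m) xs)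

n<m^n : ∀ {m} → 1 < m → ∀ n → n < m ^ n
n<m^n 1<m zero    = z<s
n<m^n 1<m (suc n) = ≤-<-trans (n<m^n 1<m n) (^-monoʳ-< _ 1<m (n<1+n n))

*≤*+rem⇒≤ : ∀ q {m r z} → r < q → q * z ≤ q * m + r → z ≤ m
*≤*+rem⇒≤ q {m} {r} {z} r<q qz≤qm+r = ≤-pred (*-cancelˡ-< q z (suc m) (begin-strict
  q * z      ≤⟨ qz≤qm+r ⟩
  q * m + r  <⟨ +-monoʳ-< (q * m) r<q ⟩
  q * m + q  ≡⟨ +-comm (q * m) q ⟩
  q + q * m  ≡⟨ *-suc q m ⟨
  q * suc m  ∎))
  where open ≤-Reasoning

≤ᵇ-*-+rem : ∀ {q m r} → r < q → ∀ z → (q * z ≤ᵇ q * m + r) ≡ (z ≤ᵇ m)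
≤ᵇ-*-+rem {q} {m} {r} r<q z = does-⇔
  (mk⇔ (*≤*+rem⇒≤ q r<q) (λ z≤m → ≤-trans (*-monoʳ-≤ q z≤m) (m≤m+n (q * m) r)))
  (q * z ≤? q * m + r) (z ≤? m)

odd⇒coprime-2 : ∀ {q} → ¬ 2 ∣ q → Coprime q 2
odd⇒coprime-2 2∤q {zero}              (_ , 0∣2) with () ← 0∣⇒≡0 0∣2
odd⇒coprime-2 2∤q {suc zero}          _         = refl
odd⇒coprime-2 2∤q {suc (suc zero)}    (2∣q , _) = ⊥-elim (2∤q 2∣q)
odd⇒coprime-2 2∤q {suc (suc (suc i))} (_ , i∣2) with s≤s (s≤s ()) ← ∣⇒≤ i∣2

odd∣2^n⇒≡1 : ∀ {q} → ¬ 2 ∣ q → ∀ n → q ∣ 2 ^ n → q ≡ 1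
odd∣2^n⇒≡1 2∤q zero    q∣1   = ∣1⇒≡1 q∣1
odd∣2^n⇒≡1 2∤q (suc n) q∣2^n = odd∣2^n⇒≡1 2∤q n (coprime-divisor (odd⇒coprime-2 2∤q) q∣2^n)

powers-unique : ∀ K → Unique (applyUpTo (2 ^_) K)
powers-unique K = Unique.applyUpTo⁺₁ (2 ^_) K (λ i<j _ → <⇒≢ (^-monoʳ-< 2 (s<s z<s) i<j))

∈-dedup⁻ : ∀ xs {y} → y ∈ dedup xs → y ∈ xs
∈-dedup⁻ (x ∷ xs) y∈ with x ∈? dedup xs
... | yes _ = there (∈-dedup⁻ xs y∈)
∈-dedup⁻ (x ∷ xs) (here y≡x)  | no _ = here y≡x
∈-dedup⁻ (x ∷ xs) (there y∈) | no _ = there (∈-dedup⁻ xs y∈)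

∈-dedup⁺ : ∀ xs {y} → y ∈ xs → y ∈ dedup xs
∈-dedup⁺ (x ∷ xs) y∈ with x ∈? dedup xs
∈-dedup⁺ (x ∷ xs) (here refl) | yes x∈ = x∈
∈-dedup⁺ (x ∷ xs) (there y∈)  | yes _  = ∈-dedup⁺ xs y∈
∈-dedup⁺ (x ∷ xs) (here y≡x)  | no _   = here y≡x
∈-dedup⁺ (x ∷ xs) (there y∈)  | no _   = there (∈-dedup⁺ xs y∈)

dedup-unique : ∀ xs → Unique (dedup xs)
dedup-unique []       = []
dedup-unique (x ∷ xs) with x ∈? dedup xs
... | yes _  = dedup-unique xs
... | no x∉ = ¬Any⇒All¬ (dedup xs) x∉ ∷ dedup-unique xs

unique∧set⇒↭ : {xs ys : List A} → Unique xs → Unique ys →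
  (∀ {y} → y ∈ xs → y ∈ ys) → (∀ {y} → y ∈ ys → y ∈ xs) → xs ↭ ys
unique∧set⇒↭ xs! ys! xs⊆ys ys⊆xs = ∼bag⇒↭ (unique∧set⇒bag xs! ys! (mk⇔ xs⊆ys ys⊆xs))

IsTerm : ℕ → ℕ → Set
IsTerm q y = ∃₂ λ a b → y ≡ 2 ^ a * q ^ b

IsTerm-cases : ∀ {q y} → IsTerm q y → (∃ λ a → y ≡ 2 ^ a) ⊎ (∃ λ z → IsTerm q z × y ≡ q * z)
IsTerm-cases     (a , zero  , refl) = inj₁ (a , *-identityʳ (2 ^ a))
IsTerm-cases {q} (a , suc b , refl) = inj₂ (2 ^ a * q ^ b , (a , b , refl) , *-CS.x∙yz≈y∙xz (2 ^ a) q (q ^ b))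

IsTerm-* : ∀ {q z} → IsTerm q z → IsTerm q (q * z)
IsTerm-* {q} (a , b , refl) = a , suc b , *-CS.x∙yz≈y∙xz q (2 ^ a) (q ^ b)

∈-terms⁻ : ∀ q n {y} → y ∈ terms q n → IsTerm q y × y ≤ n
∈-terms⁻ q n y∈ with ∈-filter⁻ (_≤? n) (∈-dedup⁻ _ y∈)
... | y∈candidates , y≤n with satisfied (∈-concatMap⁻ _ {xs = upTo (n + 1)} y∈candidates)
... | a , y∈row with ∈-map⁻ _ y∈row
... | b , _ , y≡ = (a , b , y≡) , y≤n

∈-terms⁺ : ∀ q n {y} → 1 < q → IsTerm q y → y ≤ n → y ∈ terms q n
∈-terms⁺ q n 1<q (a , b , refl) y≤n = ∈-dedup⁺ _ (∈-filter⁺ (_≤? n)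
  (∈-concatMap⁺ _ (lose (∈-upTo⁺ (exponent< (n<m^n (s<s z<s) a) 2^a≤y))
                        (∈-map⁺ _ (∈-upTo⁺ (exponent< (n<m^n 1<q b) q^b≤y))))) y≤n)
  where
  instance
    q≢0 : NonZero q
    q≢0 = >-nonZero (<-trans z<s 1<q)
  2^a≤y : 2 ^ a ≤ 2 ^ a * q ^ b
  2^a≤y = m≤m*n (2 ^ a) (q ^ b) {{m^n≢0 q b}}
  q^b≤y : q ^ b ≤ 2 ^ a * q ^ b
  q^b≤y = m≤n*m (q ^ b) (2 ^ a) {{m^n≢0 2 a}}
  exponent< : ∀ {e x} → e < x → x ≤ 2 ^ a * q ^ b → e < n + 1
  exponent< e<x x≤y = <-≤-trans e<x (≤-trans x≤y (≤-trans y≤n (m≤m+n n 1)))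

terms-unique : ∀ q n → Unique (terms q n)
terms-unique q n = dedup-unique (filter (_≤? n) (concatMap (λ a → map (λ b → 2 ^ a * q ^ b) (upTo (n + 1))) (upTo (n + 1))))

filter-terms : ∀ {q m j} → 1 < q → j ≤ m → filter (_≤? j) (terms q m) ↭ terms q j
filter-terms {q} {m} {j} 1<q j≤m =
  unique∧set⇒↭ (Unique.filter⁺ (_≤? j) (terms-unique q m)) (terms-unique q j) to from
  where
  to : ∀ {y} → y ∈ filter (_≤? j) (terms q m) → y ∈ terms q j
  to y∈ with y∈terms , y≤j ← ∈-filter⁻ (_≤? j) y∈ = ∈-terms⁺ q j 1<q (proj₁ (∈-terms⁻ q m y∈terms)) y≤j
  from : ∀ {y} → y ∈ terms q j → y ∈ filter (_≤? j) (terms q m)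
  from y∈ with y-term , y≤j ← ∈-terms⁻ q j y∈ = ∈-filter⁺ (_≤? j) (∈-terms⁺ q m 1<q y-term (≤-trans y≤j j≤m)) y≤j

terms-split : ∀ {q m r} → 1 < q → ¬ 2 ∣ q → r < q →
  terms q (q * m + r) ↭ filter (_≤? q * m + r) (map (q *_) (terms q m) ++ applyUpTo (2 ^_) (q * m + r))
terms-split {q} {m} {r} 1<q 2∤q r<q = unique∧set⇒↭ (terms-unique q n)
  (Unique.filter⁺ (_≤? n) (Unique.++⁺ (Unique.map⁺ (*-cancelˡ-≡ _ _ q) (terms-unique q m)) (powers-unique n) disjoint))
  (λ y∈ → let y-term , y≤n = ∈-terms⁻ q n y∈ in ∈-filter⁺ (_≤? n) (to (IsTerm-cases y-term) y≤n) y≤n)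
  (λ y∈ → let y∈qT++P , y≤n = ∈-filter⁻ (_≤? n) y∈ in ∈-terms⁺ q n 1<q (from (∈-++⁻ qT y∈qT++P)) y≤n)
  where
  n : ℕ
  n = q * m + r
  qT : List ℕ
  qT = map (q *_) (terms q m)
  instance
    q≢0 : NonZero q
    q≢0 = >-nonZero (<-trans z<s 1<q)
  disjoint : Disjoint qT (applyUpTo (2 ^_) n)
  disjoint (v∈qT , v∈P) with z , _ , refl ← ∈-map⁻ (q *_) v∈qT | a , _ , qz≡2^a ← ∈-applyUpTo⁻ (2 ^_) v∈P =
    <⇒≢ 1<q (sym (odd∣2^n⇒≡1 2∤q a (divides z (≡.trans (sym qz≡2^a) (*-comm q z)))))
  to : ∀ {y} → (∃ λ a → y ≡ 2 ^ a) ⊎ (∃ λ z → IsTerm q z × y ≡ q * z) → y ≤ n → y ∈ qT ++ applyUpTo (2 ^_) n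
  to (inj₁ (a , refl)) 2^a≤n = ∈-++⁺ʳ qT (∈-applyUpTo⁺ (2 ^_) (<-≤-trans (n<m^n (s<s z<s) a) 2^a≤n))
  to (inj₂ (z , z-term , refl)) qz≤n = ∈-++⁺ˡ (∈-map⁺ (q *_) (∈-terms⁺ q m 1<q z-term (*≤*+rem⇒≤ q r<q qz≤n)))
  from : ∀ {y} → y ∈ qT ⊎ y ∈ applyUpTo (2 ^_) n → IsTerm q y
  from (inj₁ y∈qT) with z , z∈T , refl ← ∈-map⁻ (q *_) y∈qT = IsTerm-* (proj₁ (∈-terms⁻ q m z∈T))
  from (inj₂ y∈P) with a , _ , refl ← ∈-applyUpTo⁻ (2 ^_) y∈P = a , 0 , sym (*-identityʳ (2 ^ a))

f≡Σsublists : ∀ q n → f q n ≡ Σsublists (λ t → 𝟙 (t ≡ᵇ n)) (terms q n)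
f≡Σsublists q n = ≡.trans (length-filter≡sum (λ s → sum s ≟ n) (sublists (terms q n)))
                          (sum-map-sublists (λ t → 𝟙 (t ≡ᵇ n)) (terms q n))

Σsublists-terms : ∀ {q m j} → 1 < q → j ≤ m → Σsublists (λ t → 𝟙 (t ≡ᵇ j)) (terms q m) ≡ f q j
Σsublists-terms {q} {m} {j} 1<q j≤m = begin
  Σsublists (λ t → 𝟙 (t ≡ᵇ j)) (terms q m)                      ≡⟨ Σsublists-filter-≤ j 𝟙≡ᵇ-above (terms q m) ⟨
  Σsublists (λ t → 𝟙 (t ≡ᵇ j)) (filter (_≤? j) (terms q m))     ≡⟨ Σsublists-↭ (filter-terms 1<q j≤m) _ ⟩
  Σsublists (λ t → 𝟙 (t ≡ᵇ j)) (terms q j)                      ≡⟨ f≡Σsublists q j ⟨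
  f q j                                                         ∎
  where open ≡-Reasoning

corollary6 : ∀ (q m r n : ℕ) → 2 < q → ¬ (2 ∣ q) → r < q → 1 ≤ m → n ≡ q * m + r →
    f q n ≡ 1 + sum (map (f q) (applyUpTo Data.Nat.suc m))
-- The last step uses f q 0 = 1
-- (the empty set), which holds by computation.
corollary6 q m r n 2<q 2∤q r<q _ refl = begin
  f q n                                                       ≡⟨ f≡Σsublists q n ⟩
  Σsublists (λ t → 𝟙 (t ≡ᵇ n)) (terms q n)                     ≡⟨ Σsublists-↭ (terms-split 1<q 2∤q r<q) _ ⟩
  Σsublists (λ t → 𝟙 (t ≡ᵇ n)) (filter (_≤? n) (qT ++ P))      ≡⟨ Σsublists-filter-≤ n 𝟙≡ᵇ-above (qT ++ P) ⟩
  Σsublists (λ t → 𝟙 (t ≡ᵇ n)) (qT ++ P)                        ≡⟨ Σsublists-++-powers (n<m^n (s<s z<s) n) qT ⟩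
  Σsublists (λ t → 𝟙 (t ≤ᵇ n)) qT                               ≡⟨ Σsublists-map-* _ q (terms q m) ⟩
  Σsublists (λ z → 𝟙 (q * z ≤ᵇ n)) (terms q m)                  ≡⟨ Σsublists-cong (cong 𝟙 ∘ ≤ᵇ-*-+rem r<q) (terms q m) ⟩
  Σsublists (λ z → 𝟙 (z ≤ᵇ m)) (terms q m)                      ≡⟨ Σsublists-≤ᵇ m (terms q m) ⟩
  sum (applyUpTo (λ j → Σsublists (λ t → 𝟙 (t ≡ᵇ j)) (terms q m)) (suc m))
                                                              ≡⟨ sum-applyUpTo-cong (suc m) (Σsublists-terms 1<q ∘ ≤-pred) ⟩
  sum (applyUpTo (f q) (suc m))                                ≡⟨ cong (1 +_) (cong sum (map-applyUpTo suc (f q) m)) ⟨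
  1 + sum (map (f q) (applyUpTo suc m))                        ∎
  where
  open ≡-Reasoning
  1<q : 1 < q
  1<q = <⇒≤ 2<q
  qT P : List ℕ
  qT = map (q *_) (terms q m)
  P  = applyUpTo (2 ^_) n
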